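{- For all integers $r,n\ge0$ there is a bijection $\phi^{\mathrm{pix}}:D_n^*(r)\to W_n(r)$, $(w_0,(w_1,i_1),\dots,(w_m,i_m))\mapsto w$, such that $$i_1+\cdots+i_m=\mathrm{wlec}\,w,\qquad i_1+\cdots+i_m+\mathrm{tot}\,w_0+\mathrm{tot}\,w_1+\cdots+\mathrm{tot}\,w_m=\mathrm{tot}\,w,\qquad \lambda w_0=\mathrm{wpix}\,w.$$
   Context: $W_n(r)=\{0,\dots,r\}^n$. For a word $c$, $\lambda c$ is its length and $\mathrm{tot}\,c$ the sum of its letters. $\mathrm{NIW}(r)$: nonincreasing words (any length $\ge0$) with letters in $\{0,\dots,r\}$. $D(r)$: pairs $(w,i)$ with $w\in\mathrm{NIW}(r-1)$, $\lambda w\ge2$, $1\le i\le\lambda w-1$. $D_n^*(r)$: sequences $(w_0,(w_1,i_1),\dots,(w_m,i_m))$, $m\ge 0$, with $w_0\in\mathrm{NIW}(r)$, $(w_j,i_j)\in D(r)$, $\lambda w_0+\cdots+\lambda w_m=n$. An $H$-word is a word $x_1\cdots x_k$ of nonnegative integers with $k\ge2$, $x_1<x_2$, and either $k=2$ or $x_2\ge x_3\ge\cdots\ge x_k$. Every word $w$ factors uniquely as $u\,h_1\cdots h_k$ with $u$ nonincreasing (possibly empty) and each $h_i$ an $H$-word (the $H$-factorization). Then $\mathrm{wpix}\,w=\lambda u$ and $\mathrm{wlec}\,w=\sum_{i=1}^k\mathrm{rinv}\,h_i$, where $\mathrm{rinv}\,h=\mathrm{inv}$ of the reverse of $h$, and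 $\mathrm{inv}$ of a word is the number of pairs of positions $a<b$ with $x_a>x_b$. -}

module Defs where

open import Data.Nat using (ℕ; zero; suc; _+_; _≤_; _<_; _<?_; _<ᵇ_)
open import Data.Bool using (if_then_else_)
open import Data.List using (List; []; _∷_; _++_; [_]; length; map; reverse)
open import Data.Nat.ListAction using (sum)
open import Data.List.Relation.Unary.All using (All)
open import Data.List.Relation.Unary.Linked using (Linked)
open import Data.Product using (Σ; _×_; _,_; proj₁; proj₂)
open import Relation.Nullary using (yes; no)
open import Relation.Binary.PropositionalEquality using (_≡_)

Word : Set
Word = List ℕ

tot : Word → ℕ
tot = sum

W : ℕ → ℕ → Set
W n r = Σ Word (λ w → length w ≡ n × All (_≤ r) w)

NonIncreasing : Word → Set
NonIncreasing = Linked (λ a b → b ≤ a)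

NIW : ℕ → Set
NIW r = Σ Word (λ w → NonIncreasing w × All (_≤ r) w)

-- D(r): pairs (w,i), w ∈ NIW(r-1) (letters in {0,…,r-1}, i.e. < r),
-- λw ≥ 2, 1 ≤ i ≤ λw - 1.
D : ℕ → Set
D r = Σ Word (λ w → NonIncreasing w × All (_< r) w ×
        Σ ℕ (λ i → 2 ≤ length w × 1 ≤ i × suc i ≤ length w))

D-word : ∀ {r} → D r → Word
D-word = proj₁

D-index : ∀ {r} → D r → ℕ
D-index d = proj₁ (proj₂ (proj₂ (proj₂ d)))

Dstar : ℕ → ℕ → Set
Dstar n r = Σ (NIW r) (λ w₀ → Σ (List (D r)) (λ ds →
              length (proj₁ w₀) + sum (map (λ d → length (D-word d)) ds) ≡ n))

inv : Word → ℕ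
inv [] = 0
inv (x ∷ xs) = sum (map (λ y → if y <ᵇ x then 1 else 0) xs) + inv xs

rinv : Word → ℕ
rinv h = inv (reverse h)

-- H-factorization w = u h₁ ⋯ h_k, computed by scanning w from the right:
-- the last H-factor starts at the last ascent position (x_a < x_{a+1}),
-- and the procedure is repeated on the remaining prefix; when the prefix
-- has no ascent it is u.  Input of hfStart/hfRun is the REVERSED word.
mutual
  hfStart : List ℕ → Word × List Word
  hfStart [] = ([] , [])
  hfStart (y ∷ ys) = hfRun y (y ∷ []) ys

  -- p = leftmost letter of the current segment acc (acc in original order)
  hfRun : ℕ → Word → List ℕ → Word × List Word
  hfRun p acc [] = (acc , [])
  hfRun p acc (y ∷ ys) with y <? p
  ... | yes _ = (proj₁ (hfStart ys) , proj₂ (hfStart ys) ++ [ y ∷ acc ])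
  ... | no _ = hfRun y (y ∷ acc) ys

hfact : Word → Word × List Word
hfact w = hfStart (reverse w)

wpix : Word → ℕ
wpix w = length (proj₁ (hfact w))

wlec : Word → ℕ
wlec w = sum (map rinv (proj₂ (hfact w)))

{-# OPTIONS --safe #-}
-- A word factors uniquely as u h₁ ⋯ h_k with u nonincreasing and every h_j an H-word, so it
-- suffices to biject D(r) with the H-words over {0,…,r}.  The map sends (w₁ ⋯ w_l , i) to
-- w_{i+1} (w₁+1) ⋯ (w_i+1) w_{i+2} ⋯ w_l.  As w is nonincreasing, everything after the first
-- letter is nonincreasing and exactly the i raised letters exceed it, so the H-word has rinv = i
-- and total tot w + i.  It is inverted by cutting the letters exceeding the first one, lowering them
-- and reinserting the first letter behind them.  Summing over the factors gives wlec and tot,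
-- and wpix is the length of u.

module Submission where

open import Defs
open import Data.Bool using (true; false; if_then_else_)
open import Data.Bool.Properties using (T-≡)
open import Data.List using (List; []; _∷_; _++_; [_]; _∷ʳ_; length; map; reverse; concat; takeWhile; dropWhile)
open import Data.List.Properties
  using (map-++; map-∘; map-id; map-id-local; map-cong; length-map; length-++; reverse-map; unfold-reverse;
         reverse-++; reverse-involutive; ++-assoc; ++-identityʳ; concat-++; takeWhile++dropWhile)
open import Data.List.Relation.Binary.Permutation.Propositional using (↭-sym)
open import Data.List.Relation.Binary.Permutation.Propositional.Properties using (↭-reverse; All-resp-↭)
open import Data.List.Relation.Unary.All as All using (All; []; _∷_)
open import Data.List.Relation.Unary.All.Properties using (++⁺; ++⁻ˡ; ++⁻ʳ; concat⁺; concat⁻; map⁺; takeWhile⁺; all-takeWhile)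
open import Data.List.Relation.Unary.Linked as Linked using ([]; [-]; _∷_)
open import Data.List.Relation.Unary.Linked.Properties using (Linked⇒All)
open import Data.Nat using (ℕ; zero; suc; pred; _+_; _≤_; _<_; _<?_; _<ᵇ_; z≤n; s≤s; z<s)
open import Data.Nat.ListAction using (sum)
open import Data.Nat.ListAction.Properties using (sum-++; sum-↭)
open import Data.Nat.Properties
  using (≤-trans; <-≤-trans; ≤-<-trans; <⇒≤; ≤⇒≯; n≤1+n; pred-mono-≤; m<m+n; +-comm; +-assoc; +-identityʳ;
         <ᵇ-reflects-<; <⇒<ᵇ; ≮⇒≥; ≤-irrelevant; <-irrelevant; ≡-irrelevant; +-commutativeSemigroup; module ≤-Reasoning)
open import Algebra.Properties.CommutativeSemigroup +-commutativeSemigroup using (interchange; x∙yz≈y∙xz)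
open import Data.Product using (Σ; _×_; _,_; proj₁; proj₂; uncurry)
open import Function using (_∘_; flip; Equivalence)
open import Function.Bundles using (_⤖_; Bijection; mk↔ₛ′)
open import Function.Definitions using (Injective)
open import Function.Properties.Inverse using (↔⇒⤖)
open import Relation.Nullary using (yes; no; contradiction)
open import Relation.Nullary.Reflects using (ofʸ; ofⁿ)
open import Relation.Unary using (Decidable; ∁)
open import Relation.Binary.PropositionalEquality using (_≡_; refl; sym; trans; cong; cong₂; subst; module ≡-Reasoning)

<ᵇ≡true : ∀ {m n} → m < n → (m <ᵇ n) ≡ true
<ᵇ≡true m<n = Equivalence.to T-≡ (<⇒<ᵇ m<n)

<ᵇ≡false : ∀ {m n} → n ≤ m → (m <ᵇ n) ≡ false
<ᵇ≡false {m} {n} n≤m with m <ᵇ n | <ᵇ-reflects-< m n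
... | false | _       = refl
... | true  | ofʸ m<n = contradiction m<n (≤⇒≯ n≤m)

above : ℕ → ℕ → ℕ
above x y = if x <ᵇ y then 1 else 0

countAbove : ℕ → Word → ℕ
countAbove x ys = sum (map (above x) ys)

countAbove-≤ : ∀ {x ys} → All (_≤ x) ys → countAbove x ys ≡ 0
countAbove-≤ []           = refl
countAbove-≤ (y≤x ∷ ys≤x) rewrite <ᵇ≡false y≤x = countAbove-≤ ys≤x

countAbove-> : ∀ {x ys} → All (x <_) ys → countAbove x ys ≡ length ys
countAbove-> []           = refl
countAbove-> (x<y ∷ x<ys) rewrite <ᵇ≡true x<y = cong suc (countAbove-> x<ys)

countAbove-++ : ∀ x ys zs → countAbove x (ys ++ zs) ≡ countAbove x ys + countAbove x zs
countAbove-++ x ys zs = trans (cong sum (map-++ (above x) ys zs)) (sum-++ (map (above x) ys) (map (above x) zs))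

countAbove-reverse : ∀ x ys → countAbove x (reverse ys) ≡ countAbove x ys
countAbove-reverse x ys = trans (cong sum (reverse-map (above x) ys)) (sum-↭ (↭-reverse (map (above x) ys)))

inv-∷ʳ : ∀ xs z → inv (xs ∷ʳ z) ≡ inv xs + countAbove z xs
inv-∷ʳ []       z = refl
inv-∷ʳ (x ∷ xs) z = begin
  sum (map below (xs ++ [ z ])) + inv (xs ∷ʳ z)
    ≡⟨ cong₂ _+_ (trans (cong sum (map-++ below xs [ z ])) (sum-++ (map below xs) [ below z ])) (inv-∷ʳ xs z) ⟩
  (sum (map below xs) + (below z + 0)) + (inv xs + countAbove z xs)
    ≡⟨ cong (λ k → (sum (map below xs) + k) + _) (+-identityʳ (below z)) ⟩
  (sum (map below xs) + below z) + (inv xs + countAbove z xs)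
    ≡⟨ interchange (sum (map below xs)) (below z) (inv xs) (countAbove z xs) ⟩
  (sum (map below xs) + inv xs) + (below z + countAbove z xs) ∎
  where
  open ≡-Reasoning
  below : ℕ → ℕ
  below y = above y x

nonincreasing-bound : ∀ {y t} → NonIncreasing (y ∷ t) → All (_≤ y) t
nonincreasing-bound [-]            = []
nonincreasing-bound (z≤y ∷ z∷t-ni) = Linked⇒All (flip ≤-trans) z≤y z∷t-ni

nonincreasing-++⁻ʳ : ∀ a {b} → NonIncreasing (a ++ b) → NonIncreasing b
nonincreasing-++⁻ʳ []      ni = ni
nonincreasing-++⁻ʳ (_ ∷ a) ni = nonincreasing-++⁻ʳ a (Linked.tail ni)

inv-reverse-nonincreasing : ∀ {t} → NonIncreasing t → inv (reverse t) ≡ 0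
inv-reverse-nonincreasing {[]}    _  = refl
inv-reverse-nonincreasing {y ∷ t} ni = begin
  inv (reverse (y ∷ t))                      ≡⟨ cong inv (unfold-reverse y t) ⟩
  inv (reverse t ∷ʳ y)                       ≡⟨ inv-∷ʳ (reverse t) y ⟩
  inv (reverse t) + countAbove y (reverse t) ≡⟨ cong₂ _+_ (inv-reverse-nonincreasing (Linked.tail ni)) (countAbove-reverse y t) ⟩
  countAbove y t                             ≡⟨ countAbove-≤ (nonincreasing-bound ni) ⟩
  0                                          ∎
  where open ≡-Reasoning

rinv-∷-nonincreasing : ∀ x {t} → NonIncreasing t → rinv (x ∷ t) ≡ countAbove x t
rinv-∷-nonincreasing x {t} ni = begin
  inv (reverse (x ∷ t))                      ≡⟨ cong inv (unfold-reverse x t) ⟩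
  inv (reverse t ∷ʳ x)                       ≡⟨ inv-∷ʳ (reverse t) x ⟩
  inv (reverse t) + countAbove x (reverse t) ≡⟨ cong₂ _+_ (inv-reverse-nonincreasing ni) (countAbove-reverse x t) ⟩
  countAbove x t                             ∎
  where open ≡-Reasoning

data IsH : Word → Set where
  isH : ∀ {x y t} → x < y → NonIncreasing (y ∷ t) → IsH (x ∷ y ∷ t)

record IsHFactorization (w : Word) (f : Word × List Word) : Set where
  field
    nonincreasing : NonIncreasing (proj₁ f)
    factors-isH   : All IsH (proj₂ f)
    reassembles   : proj₁ f ++ concat (proj₂ f) ≡ w

reverse-∷-++ : ∀ (y : ℕ) ys zs → reverse (y ∷ ys) ++ zs ≡ reverse ys ++ y ∷ zs
reverse-∷-++ y ys zs = trans (cong (_++ zs) (unfold-reverse y ys)) (++-assoc (reverse ys) [ y ] zs)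

concat-∷ʳ : ∀ (xss : List Word) xs → concat (xss ∷ʳ xs) ≡ concat xss ++ xs
concat-∷ʳ xss xs = trans (sym (concat-++ xss [ xs ])) (cong (concat xss ++_) (++-identityʳ xs))

mutual
  hfStart-sound : ∀ ys → IsHFactorization (reverse ys) (hfStart ys)
  hfStart-sound []       = record { nonincreasing = [] ; factors-isH = [] ; reassembles = refl }
  hfStart-sound (y ∷ ys) =
    subst (λ v → IsHFactorization v (hfRun y [ y ] ys)) (sym (unfold-reverse y ys)) (hfRun-sound y [] ys [-])

  hfRun-sound : ∀ p acc ys → NonIncreasing (p ∷ acc) →
                IsHFactorization (reverse ys ++ p ∷ acc) (hfRun p (p ∷ acc) ys)
  hfRun-sound p acc []       ni = record { nonincreasing = ni ; factors-isH = [] ; reassembles = ++-identityʳ (p ∷ acc) }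
  hfRun-sound p acc (y ∷ ys) ni with y <? p
  ... | yes y<p = record
    { nonincreasing = nonincreasing
    ; factors-isH   = ++⁺ factors-isH (isH y<p ni ∷ [])
    ; reassembles   = begin
        u ++ concat (hs ∷ʳ h)        ≡⟨ cong (u ++_) (concat-∷ʳ hs h) ⟩
        u ++ (concat hs ++ h)        ≡⟨ sym (++-assoc u (concat hs) h) ⟩
        (u ++ concat hs) ++ h        ≡⟨ cong (_++ h) reassembles ⟩
        reverse ys ++ h              ≡⟨ sym (reverse-∷-++ y ys (p ∷ acc)) ⟩
        reverse (y ∷ ys) ++ p ∷ acc  ∎
    }
    where
    open IsHFactorization (hfStart-sound ys)
    open ≡-Reasoning
    u  = proj₁ (hfStart ys)
    hs = proj₂ (hfStart ys)
    h  = y ∷ p ∷ acc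
  ... | no y≮p = subst (λ v → IsHFactorization v (hfRun y (y ∷ p ∷ acc) ys)) (sym (reverse-∷-++ y ys (p ∷ acc)))
                   (hfRun-sound y (p ∷ acc) ys (≮⇒≥ y≮p ∷ ni))

hfact-sound : ∀ w → IsHFactorization w (hfact w)
hfact-sound w = subst (λ v → IsHFactorization v (hfact w)) (reverse-involutive w) (hfStart-sound (reverse w))

hfRun-≥ : ∀ p acc z ys → p ≤ z → hfRun p acc (z ∷ ys) ≡ hfRun z (z ∷ acc) ys
hfRun-≥ p acc z ys p≤z with z <? p
... | yes z<p = contradiction z<p (≤⇒≯ p≤z)
... | no _    = refl

hfRun-< : ∀ p acc z ys → z < p → hfRun p acc (z ∷ ys) ≡ (proj₁ (hfStart ys) , proj₂ (hfStart ys) ++ [ z ∷ acc ])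
hfRun-< p acc z ys z<p with z <? p
... | yes _   = refl
... | no z≮p  = contradiction z<p z≮p

hfStart-nonincreasing-++ : ∀ y t zs → NonIncreasing (y ∷ t) → hfStart (reverse (y ∷ t) ++ zs) ≡ hfRun y (y ∷ t) zs
hfStart-nonincreasing-++ y []      zs _          = refl
hfStart-nonincreasing-++ y (z ∷ t) zs (z≤y ∷ ni) = begin
  hfStart (reverse (y ∷ z ∷ t) ++ zs) ≡⟨ cong hfStart (reverse-∷-++ y (z ∷ t) zs) ⟩
  hfStart (reverse (z ∷ t) ++ y ∷ zs) ≡⟨ hfStart-nonincreasing-++ z t (y ∷ zs) ni ⟩
  hfRun z (z ∷ t) (y ∷ zs)            ≡⟨ hfRun-≥ z (z ∷ t) y zs z≤y ⟩
  hfRun y (y ∷ z ∷ t) zs              ∎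
  where open ≡-Reasoning

hfact-nonincreasing : ∀ u → NonIncreasing u → hfact u ≡ (u , [])
hfact-nonincreasing []      _  = refl
hfact-nonincreasing (y ∷ t) ni =
  trans (cong hfStart (sym (++-identityʳ (reverse (y ∷ t))))) (hfStart-nonincreasing-++ y t [] ni)

-- hfact peels the H-factors off from the right end of the word.
hfact-reverse-unique : ∀ u hs → NonIncreasing u → All IsH hs →
                       hfact (u ++ concat (reverse hs)) ≡ (u , reverse hs)
hfact-reverse-unique u [] ni [] rewrite ++-identityʳ u = hfact-nonincreasing u ni
hfact-reverse-unique u (h ∷ hs) ni (isH {x} {y} {t} x<y y∷t-ni ∷ hs-H) = begin
  hfact (u ++ concat (reverse (h ∷ hs)))     ≡⟨ cong hfStart reversed ⟩
  hfStart (reverse (y ∷ t) ++ x ∷ reverse w) ≡⟨ hfStart-nonincreasing-++ y t (x ∷ reverse w) y∷t-ni ⟩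
  hfRun y (y ∷ t) (x ∷ reverse w)            ≡⟨ hfRun-< y (y ∷ t) x (reverse w) x<y ⟩
  (proj₁ (hfact w) , proj₂ (hfact w) ++ [ h ]) ≡⟨ cong (λ f → proj₁ f , proj₂ f ++ [ h ]) (hfact-reverse-unique u hs ni hs-H) ⟩
  (u , reverse hs ∷ʳ h)                      ≡⟨ cong (u ,_) (sym (unfold-reverse h hs)) ⟩
  (u , reverse (h ∷ hs))                     ∎
  where
  open ≡-Reasoning
  w = u ++ concat (reverse hs)
  reversed : reverse (u ++ concat (reverse (h ∷ hs))) ≡ reverse (y ∷ t) ++ x ∷ reverse w
  reversed = begin
    reverse (u ++ concat (reverse (h ∷ hs)))    ≡⟨ cong (λ l → reverse (u ++ concat l)) (unfold-reverse h hs) ⟩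
    reverse (u ++ concat (reverse hs ∷ʳ h))     ≡⟨ cong (λ l → reverse (u ++ l)) (concat-∷ʳ (reverse hs) h) ⟩
    reverse (u ++ (concat (reverse hs) ++ h))   ≡⟨ cong reverse (sym (++-assoc u (concat (reverse hs)) h)) ⟩
    reverse (w ++ h)                            ≡⟨ reverse-++ w h ⟩
    reverse h ++ reverse w                      ≡⟨ reverse-∷-++ x (y ∷ t) (reverse w) ⟩
    reverse (y ∷ t) ++ x ∷ reverse w            ∎

hfact-unique : ∀ {u hs} → NonIncreasing u → All IsH hs → hfact (u ++ concat hs) ≡ (u , hs)
hfact-unique {u} {hs} ni hs-H =
  subst (λ l → hfact (u ++ concat l) ≡ (u , l)) (reverse-involutive hs)
        (hfact-reverse-unique u (reverse hs) ni (All-resp-↭ (↭-sym (↭-reverse hs)) hs-H))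

nonincreasing-above : ∀ a {c rest} → NonIncreasing (a ++ c ∷ rest) → All (c ≤_) a
nonincreasing-above []      _  = []
nonincreasing-above (y ∷ a) ni = All.head (++⁻ʳ a (nonincreasing-bound ni)) ∷ nonincreasing-above a (Linked.tail ni)

nonincreasing-below : ∀ a {c rest} → NonIncreasing (a ++ c ∷ rest) → All (_≤ c) rest
nonincreasing-below a ni = nonincreasing-bound (nonincreasing-++⁻ʳ a ni)

nonincreasing-raise-remove : ∀ a {c rest} → NonIncreasing (a ++ c ∷ rest) → NonIncreasing (map suc a ++ rest)
nonincreasing-raise-remove []           ni                 = Linked.tail ni
nonincreasing-raise-remove (y ∷ [])     {rest = []}    _   = [-]
nonincreasing-raise-remove (y ∷ [])     {rest = _ ∷ _} (c≤y ∷ z≤c ∷ ni) = ≤-trans z≤c (≤-trans c≤y (n≤1+n y)) ∷ ni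
nonincreasing-raise-remove (y ∷ y′ ∷ a) (y′≤y ∷ ni)        = s≤s y′≤y ∷ nonincreasing-raise-remove (y′ ∷ a) ni

nonincreasing-lower-insert : ∀ {x} a {b} → NonIncreasing (a ++ b) → All (x <_) a → All (_≤ x) b →
                             NonIncreasing (map pred a ++ x ∷ b)
nonincreasing-lower-insert []             _           []                []          = [-]
nonincreasing-lower-insert []             ni          []                (z≤x ∷ _)   = z≤x ∷ ni
nonincreasing-lower-insert (suc y ∷ [])   ni          (s≤s x≤y ∷ [])    b≤x         =
  x≤y ∷ nonincreasing-lower-insert [] (Linked.tail ni) [] b≤x
nonincreasing-lower-insert (y ∷ y′ ∷ a)   (y′≤y ∷ ni) (_ ∷ x<a)         b≤x         =
  pred-mono-≤ y′≤y ∷ nonincreasing-lower-insert (y′ ∷ a) ni x<a b≤x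

insertSecond : ℕ → Word → Word
insertSecond y []      = [ y ]
insertSecond y (c ∷ v) = c ∷ y ∷ v

length-insertSecond : ∀ y v → length (insertSecond y v) ≡ suc (length v)
length-insertSecond _ []      = refl
length-insertSecond _ (_ ∷ _) = refl

tot-insertSecond : ∀ y v → tot (insertSecond y v) ≡ y + tot v
tot-insertSecond _ []      = refl
tot-insertSecond y (c ∷ v) = x∙yz≈y∙xz c y (tot v)

All-insertSecond : ∀ {P : ℕ → Set} {y v} → P y → All P v → All P (insertSecond y v)
All-insertSecond py []        = py ∷ []
All-insertSecond py (pc ∷ pv) = pc ∷ py ∷ pv

toHWord : Word → ℕ → Word
toHWord []      _       = []
toHWord (c ∷ w) zero    = c ∷ w
toHWord (y ∷ w) (suc i) = insertSecond (suc y) (toHWord w i)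

toHWord-split : ∀ a c rest → toHWord (a ++ c ∷ rest) (length a) ≡ c ∷ map suc a ++ rest
toHWord-split []      c rest = refl
toHWord-split (y ∷ a) c rest = cong (insertSecond (suc y)) (toHWord-split a c rest)

data SplitAt : Word → ℕ → Set where
  splitAt : ∀ a c rest → SplitAt (a ++ c ∷ rest) (length a)

split : ∀ w i → i < length w → SplitAt w i
split (c ∷ rest) zero    _         = splitAt [] c rest
split (y ∷ w)    (suc i) (s≤s i<w) with split w i i<w
... | splitAt a c rest = splitAt (y ∷ a) c rest

length-toHWord : ∀ w i → length (toHWord w i) ≡ length w
length-toHWord []      _       = refl
length-toHWord (c ∷ w) zero    = refl
length-toHWord (y ∷ w) (suc i) = trans (length-insertSecond (suc y) (toHWord w i)) (cong suc (length-toHWord w i))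

tot-toHWord : ∀ w i → i < length w → tot (toHWord w i) ≡ i + tot w
tot-toHWord (c ∷ w) zero    _         = refl
tot-toHWord (y ∷ w) (suc i) (s≤s i<w) = begin
  tot (insertSecond (suc y) (toHWord w i)) ≡⟨ tot-insertSecond (suc y) (toHWord w i) ⟩
  suc y + tot (toHWord w i)                ≡⟨ cong (suc y +_) (tot-toHWord w i i<w) ⟩
  suc (y + (i + tot w))                    ≡⟨ cong suc (x∙yz≈y∙xz y i (tot w)) ⟩
  suc i + (y + tot w)                      ∎
  where open ≡-Reasoning

toHWord-bounded : ∀ {r w} i → All (_< r) w → All (_≤ r) (toHWord w i)
toHWord-bounded _       []          = []
toHWord-bounded zero    (c<r ∷ w<r) = All.map <⇒≤ (c<r ∷ w<r)
toHWord-bounded (suc i) (y<r ∷ w<r) = All-insertSecond y<r (toHWord-bounded i w<r)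

toHWord-isH : ∀ {w i} → NonIncreasing w → 1 ≤ i → i < length w → IsH (toHWord w i)
toHWord-isH {w} {i} ni 1≤i i<w with split w i i<w
toHWord-isH ni () _ | splitAt [] c rest
... | splitAt (y ∷ a) c rest rewrite toHWord-split (y ∷ a) c rest =
  isH (s≤s (All.head (nonincreasing-above (y ∷ a) ni))) (nonincreasing-raise-remove (y ∷ a) ni)

rinv-toHWord : ∀ {w i} → NonIncreasing w → i < length w → rinv (toHWord w i) ≡ i
rinv-toHWord {w} {i} ni i<w with split w i i<w
... | splitAt a c rest rewrite toHWord-split a c rest = begin
  rinv (c ∷ map suc a ++ rest)       ≡⟨ rinv-∷-nonincreasing c (nonincreasing-raise-remove a ni) ⟩
  countAbove c (map suc a ++ rest)   ≡⟨ countAbove-++ c (map suc a) rest ⟩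
  countAbove c (map suc a) + countAbove c rest
    ≡⟨ cong₂ _+_ (countAbove-> (map⁺ (All.map s≤s (nonincreasing-above a ni)))) (countAbove-≤ (nonincreasing-below a ni)) ⟩
  length (map suc a) + 0             ≡⟨ +-identityʳ _ ⟩
  length (map suc a)                 ≡⟨ length-map suc a ⟩
  length a                           ∎
  where open ≡-Reasoning

module _ {A : Set} {P : A → Set} (P? : Decidable P) where

  takeWhile-++ : ∀ {a b} → All P a → All (∁ P) b → takeWhile P? (a ++ b) ≡ a
  takeWhile-++ {b = []}    []        _         = refl
  takeWhile-++ {b = z ∷ _} []        (¬pz ∷ _) with P? z
  ... | yes pz = contradiction pz ¬pz
  ... | no  _  = refl
  takeWhile-++ {a = y ∷ _} (py ∷ pa) ¬pb with P? y
  ... | yes _   = cong (y ∷_) (takeWhile-++ pa ¬pb)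
  ... | no  ¬py = contradiction py ¬py

  dropWhile-++ : ∀ {a b} → All P a → All (∁ P) b → dropWhile P? (a ++ b) ≡ b
  dropWhile-++ {b = []}    []        _         = refl
  dropWhile-++ {b = z ∷ _} []        (¬pz ∷ _) with P? z
  ... | yes pz = contradiction pz ¬pz
  ... | no  _  = refl
  dropWhile-++ {a = y ∷ _} (py ∷ pa) ¬pb with P? y
  ... | yes _   = dropWhile-++ pa ¬pb
  ... | no  ¬py = contradiction py ¬py

dropWhile->-bounded : ∀ x {t} → NonIncreasing t → All (_≤ x) (dropWhile (x <?_) t)
dropWhile->-bounded x {[]}    _  = []
dropWhile->-bounded x {y ∷ t} ni with x <ᵇ y | <ᵇ-reflects-< x y
... | true  | ofʸ _   = dropWhile->-bounded x (Linked.tail ni)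
... | false | ofⁿ x≮y = ≮⇒≥ x≮y ∷ All.map (λ z≤y → ≤-trans z≤y (≮⇒≥ x≮y)) (nonincreasing-bound ni)

fromHWord : Word → Word × ℕ
fromHWord []      = [] , 0
fromHWord (x ∷ t) = map pred (takeWhile (x <?_) t) ++ x ∷ dropWhile (x <?_) t , length (takeWhile (x <?_) t)

fromHWord-toHWord : ∀ {w i} → NonIncreasing w → i < length w → fromHWord (toHWord w i) ≡ (w , i)
fromHWord-toHWord {w} {i} ni i<w with split w i i<w
... | splitAt a c rest = begin
  fromHWord (toHWord (a ++ c ∷ rest) (length a))          ≡⟨ cong fromHWord (toHWord-split a c rest) ⟩
  fromHWord (c ∷ map suc a ++ rest)                       ≡⟨ cong₂ (λ p q → map pred p ++ c ∷ q , length p)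
                                                               (takeWhile-++ (c <?_) c<a ¬c<rest) (dropWhile-++ (c <?_) c<a ¬c<rest) ⟩
  (map pred (map suc a) ++ c ∷ rest , length (map suc a)) ≡⟨ cong₂ (λ b k → b ++ c ∷ rest , k)
                                                               (trans (sym (map-∘ a)) (map-id a)) (length-map suc a) ⟩
  (a ++ c ∷ rest , length a)                              ∎
  where
  open ≡-Reasoning
  c<a : All (c <_) (map suc a)
  c<a = map⁺ (All.map s≤s (nonincreasing-above a ni))
  ¬c<rest : All (∁ (c <_)) rest
  ¬c<rest = All.map ≤⇒≯ (nonincreasing-below a ni)

toHWord-fromHWord : ∀ h → uncurry toHWord (fromHWord h) ≡ h
toHWord-fromHWord []      = refl
toHWord-fromHWord (x ∷ t) = begin
  toHWord (map pred A ++ x ∷ B) (length A)            ≡⟨ cong (toHWord (map pred A ++ x ∷ B)) (sym (length-map pred A)) ⟩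
  toHWord (map pred A ++ x ∷ B) (length (map pred A)) ≡⟨ toHWord-split (map pred A) x B ⟩
  x ∷ map suc (map pred A) ++ B                       ≡⟨ cong (λ a → x ∷ a ++ B) map-suc-pred ⟩
  x ∷ A ++ B                                          ≡⟨ cong (x ∷_) (takeWhile++dropWhile (x <?_) t) ⟩
  x ∷ t                                               ∎
  where
  open ≡-Reasoning
  A = takeWhile (x <?_) t
  B = dropWhile (x <?_) t
  map-suc-pred : map suc (map pred A) ≡ A
  map-suc-pred = trans (sym (map-∘ A)) (map-id-local (All.map (λ { (s≤s _) → refl }) (all-takeWhile (x <?_) t)))

fromHWord-nonincreasing : ∀ x {t} → NonIncreasing t → NonIncreasing (proj₁ (fromHWord (x ∷ t)))
fromHWord-nonincreasing x {t} ni =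
  nonincreasing-lower-insert (takeWhile (x <?_) t)
    (subst NonIncreasing (sym (takeWhile++dropWhile (x <?_) t)) ni)
    (all-takeWhile (x <?_) t) (dropWhile->-bounded x ni)

fromHWord-bounded : ∀ {x t r} → x < r → All (_≤ r) t → NonIncreasing t → All (_< r) (proj₁ (fromHWord (x ∷ t)))
fromHWord-bounded {x} {t} {r} x<r t≤r ni =
  ++⁺ (map⁺ (All.zipWith pred< (all-takeWhile (x <?_) t , takeWhile⁺ (x <?_) t≤r)))
      (x<r ∷ All.map (λ z≤x → ≤-<-trans z≤x x<r) (dropWhile->-bounded x ni))
  where
  pred< : ∀ {v} → x < v × v ≤ r → pred v < r
  pred< (s≤s _ , v≤r) = v≤r

fromHWord-index-positive : ∀ {x y t} → x < y → 1 ≤ proj₂ (fromHWord (x ∷ y ∷ t))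
fromHWord-index-positive {x} {y} x<y with x <ᵇ y | <ᵇ-reflects-< x y
... | true  | _       = s≤s z≤n
... | false | ofⁿ x≮y = contradiction x<y x≮y

fromHWord-index-< : ∀ x t → proj₂ (fromHWord (x ∷ t)) < length (proj₁ (fromHWord (x ∷ t)))
fromHWord-index-< x t = begin-strict
  length A                             <⟨ m<m+n (length A) z<s ⟩
  length A + length (x ∷ B)            ≡⟨ cong (_+ length (x ∷ B)) (sym (length-map pred A)) ⟩
  length (map pred A) + length (x ∷ B) ≡⟨ sym (length-++ (map pred A)) ⟩
  length (map pred A ++ x ∷ B)         ∎
  where
  open ≤-Reasoning
  A = takeWhile (x <?_) t
  B = dropWhile (x <?_) t

D-pair : ∀ {r} → D r → Word × ℕ
D-pair d = D-word d , D-index d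

D-pair-injective : ∀ {r} → Injective _≡_ _≡_ (D-pair {r})
D-pair-injective {x = _ , ni , w<r , _ , p , q , s} {y = _ , ni′ , w<r′ , _ , p′ , q′ , s′} refl
  rewrite Linked.irrelevant ≤-irrelevant ni ni′ | All.irrelevant <-irrelevant w<r w<r′
        | ≤-irrelevant p p′ | ≤-irrelevant q q′ | ≤-irrelevant s s′ = refl

hword : ∀ {r} → D r → Word
hword d = toHWord (D-word d) (D-index d)

hword-isH : ∀ {r} (d : D r) → IsH (hword d)
hword-isH (_ , ni , _ , _ , _ , 1≤i , i<w) = toHWord-isH ni 1≤i i<w

hword-bounded : ∀ {r} (d : D r) → All (_≤ r) (hword d)
hword-bounded (_ , _ , w<r , i , _) = toHWord-bounded i w<r

length-hword : ∀ {r} (d : D r) → length (hword d) ≡ length (D-word d)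
length-hword d = length-toHWord (D-word d) (D-index d)

tot-hword : ∀ {r} (d : D r) → tot (hword d) ≡ D-index d + tot (D-word d)
tot-hword (w , _ , _ , i , _ , _ , i<w) = tot-toHWord w i i<w

rinv-hword : ∀ {r} (d : D r) → rinv (hword d) ≡ D-index d
rinv-hword (_ , ni , _ , _ , _ , _ , i<w) = rinv-toHWord ni i<w

fromHWord-hword : ∀ {r} (d : D r) → fromHWord (hword d) ≡ D-pair d
fromHWord-hword (_ , ni , _ , _ , _ , _ , i<w) = fromHWord-toHWord ni i<w

unhword : ∀ {r h} → IsH h → All (_≤ r) h → D r
unhword {h = x ∷ y ∷ t} (isH x<y y∷t-ni) (_ ∷ y∷t≤r) =
  w , fromHWord-nonincreasing x y∷t-ni , fromHWord-bounded x<r y∷t≤r y∷t-ni ,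
  i , ≤-trans (s≤s 1≤i) i<w , 1≤i , i<w
  where
  w   = proj₁ (fromHWord (x ∷ y ∷ t))
  i   = proj₂ (fromHWord (x ∷ y ∷ t))
  1≤i = fromHWord-index-positive x<y
  i<w = fromHWord-index-< x (y ∷ t)
  x<r = <-≤-trans x<y (All.head y∷t≤r)

D-pair-unhword : ∀ {r h} (h-H : IsH h) (h≤r : All (_≤ r) h) → D-pair (unhword h-H h≤r) ≡ fromHWord h
D-pair-unhword (isH _ _) (_ ∷ _) = refl

hword-unhword : ∀ {r h} (h-H : IsH h) (h≤r : All (_≤ r) h) → hword (unhword h-H h≤r) ≡ h
hword-unhword {h = h} (isH _ _) (_ ∷ _) = toHWord-fromHWord h

unhword-hword : ∀ {r} (d : D r) h-H h≤r → unhword h-H h≤r ≡ d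
unhword-hword d h-H h≤r = D-pair-injective (trans (D-pair-unhword h-H h≤r) (fromHWord-hword d))

unhwords : ∀ {r hs} → All IsH hs → All (All (_≤ r)) hs → List (D r)
unhwords []           []           = []
unhwords (h-H ∷ hs-H) (h≤r ∷ hs≤r) = unhword h-H h≤r ∷ unhwords hs-H hs≤r

map-hword-unhwords : ∀ {r hs} (hs-H : All IsH hs) (hs≤r : All (All (_≤ r)) hs) → map hword (unhwords hs-H hs≤r) ≡ hs
map-hword-unhwords []           []           = refl
map-hword-unhwords (h-H ∷ hs-H) (h≤r ∷ hs≤r) = cong₂ _∷_ (hword-unhword h-H h≤r) (map-hword-unhwords hs-H hs≤r)

unhwords-map-hword : ∀ {r hs} (ds : List (D r)) → hs ≡ map hword ds →
                     (hs-H : All IsH hs) (hs≤r : All (All (_≤ r)) hs) → unhwords hs-H hs≤r ≡ ds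
unhwords-map-hword []       refl []           []           = refl
unhwords-map-hword (d ∷ ds) refl (h-H ∷ hs-H) (h≤r ∷ hs≤r) =
  cong₂ _∷_ (unhword-hword d h-H h≤r) (unhwords-map-hword ds refl hs-H hs≤r)

length-concat-hword : ∀ {r} (ds : List (D r)) → length (concat (map hword ds)) ≡ sum (map (length ∘ D-word) ds)
length-concat-hword []       = refl
length-concat-hword (d ∷ ds) =
  trans (length-++ (hword d)) (cong₂ _+_ (length-hword d) (length-concat-hword ds))

tot-concat-hword : ∀ {r} (ds : List (D r)) →
                   tot (concat (map hword ds)) ≡ sum (map D-index ds) + sum (map (tot ∘ D-word) ds)
tot-concat-hword []       = refl
tot-concat-hword (d ∷ ds) = begin
  tot (hword d ++ concat (map hword ds))                ≡⟨ sum-++ (hword d) (concat (map hword ds)) ⟩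
  tot (hword d) + tot (concat (map hword ds))           ≡⟨ cong₂ _+_ (tot-hword d) (tot-concat-hword ds) ⟩
  (D-index d + tot (D-word d)) + (sum (map D-index ds) + sum (map (tot ∘ D-word) ds))
    ≡⟨ interchange (D-index d) (tot (D-word d)) (sum (map D-index ds)) (sum (map (tot ∘ D-word) ds)) ⟩
  (D-index d + sum (map D-index ds)) + (tot (D-word d) + sum (map (tot ∘ D-word) ds)) ∎
  where open ≡-Reasoning

hfact-hwords : ∀ {r u} (ds : List (D r)) → NonIncreasing u → hfact (u ++ concat (map hword ds)) ≡ (u , map hword ds)
hfact-hwords ds ni = hfact-unique ni (map⁺ (All.universal hword-isH ds))

module _ {r n : ℕ} where

  W-≡ : {v w : W n r} → proj₁ v ≡ proj₁ w → v ≡ w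
  W-≡ {_ , l , b} {_ , l′ , b′} refl = cong₂ (λ p q → _ , p , q) (≡-irrelevant l l′) (All.irrelevant ≤-irrelevant b b′)

  Dstar-≡ : {d e : Dstar n r} → proj₁ (proj₁ d) ≡ proj₁ (proj₁ e) → proj₁ (proj₂ d) ≡ proj₁ (proj₂ e) → d ≡ e
  Dstar-≡ {(_ , ni , b) , _ , l} {(_ , ni′ , b′) , _ , l′} refl refl
    rewrite Linked.irrelevant ≤-irrelevant ni ni′ | All.irrelevant ≤-irrelevant b b′ | ≡-irrelevant l l′ = refl

  toW : Dstar n r → W n r
  toW ((u , _ , u≤r) , ds , len) =
    u ++ concat (map hword ds) ,
    trans (length-++ u) (trans (cong (length u +_) (length-concat-hword ds)) len) ,
    ++⁺ u≤r (concat⁺ (map⁺ (All.universal hword-bounded ds)))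

  hfact-bounded : ∀ w → All (_≤ r) w → All (_≤ r) (proj₁ (hfact w)) × All (All (_≤ r)) (proj₂ (hfact w))
  hfact-bounded w w≤r = ++⁻ˡ u uhs≤r , concat⁻ (++⁻ʳ u uhs≤r)
    where
    u = proj₁ (hfact w)
    uhs≤r = subst (All (_≤ r)) (sym (IsHFactorization.reassembles (hfact-sound w))) w≤r

  fromW : W n r → Dstar n r
  fromW (w , len , w≤r) = (u , nonincreasing , proj₁ bounds) , ds , ds-length
    where
    open IsHFactorization (hfact-sound w)
    open ≡-Reasoning
    u = proj₁ (hfact w)
    hs = proj₂ (hfact w)
    bounds = hfact-bounded w w≤r
    ds = unhwords factors-isH (proj₂ bounds)
    ds-length : length u + sum (map (length ∘ D-word) ds) ≡ n
    ds-length = begin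
      length u + sum (map (length ∘ D-word) ds)  ≡⟨ cong (length u +_) (sym (length-concat-hword ds)) ⟩
      length u + length (concat (map hword ds))  ≡⟨ cong (λ l → length u + length (concat l)) (map-hword-unhwords factors-isH (proj₂ bounds)) ⟩
      length u + length (concat hs)              ≡⟨ sym (length-++ u) ⟩
      length (u ++ concat hs)                    ≡⟨ cong length reassembles ⟩
      length w                                   ≡⟨ len ⟩
      n                                          ∎

  toW-fromW : ∀ w → toW (fromW w) ≡ w
  toW-fromW (w , _ , w≤r) = W-≡ (begin
    u ++ concat (map hword (unhwords factors-isH (proj₂ (hfact-bounded w w≤r))))
      ≡⟨ cong (λ l → u ++ concat l) (map-hword-unhwords factors-isH (proj₂ (hfact-bounded w w≤r))) ⟩
    u ++ concat (proj₂ (hfact w)) ≡⟨ reassembles ⟩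
    w                             ∎)
    where
    open IsHFactorization (hfact-sound w)
    open ≡-Reasoning
    u = proj₁ (hfact w)

  fromW-toW : ∀ d → fromW (toW d) ≡ d
  fromW-toW ((u , ni , _) , ds , _) = Dstar-≡ (cong proj₁ (hfact-hwords ds ni))
                                             (unhwords-map-hword ds (cong proj₂ (hfact-hwords ds ni)) _ _)

  wlec-toW : ∀ d → sum (map D-index (proj₁ (proj₂ d))) ≡ wlec (proj₁ (toW d))
  wlec-toW ((u , ni , _) , ds , _) = begin
    sum (map D-index ds)              ≡⟨ cong sum (sym (map-cong rinv-hword ds)) ⟩
    sum (map (rinv ∘ hword) ds)       ≡⟨ cong sum (map-∘ ds) ⟩
    sum (map rinv (map hword ds))     ≡⟨ cong (sum ∘ map rinv ∘ proj₂) (sym (hfact-hwords ds ni)) ⟩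
    wlec (u ++ concat (map hword ds)) ∎
    where open ≡-Reasoning

  tot-toW : ∀ d → sum (map D-index (proj₁ (proj₂ d))) + tot (proj₁ (proj₁ d))
                    + sum (map (tot ∘ D-word) (proj₁ (proj₂ d)))
                  ≡ tot (proj₁ (toW d))
  tot-toW ((u , _ , _) , ds , _) = begin
    I + tot u + T                        ≡⟨ cong (_+ T) (+-comm I (tot u)) ⟩
    tot u + I + T                        ≡⟨ +-assoc (tot u) I T ⟩
    tot u + (I + T)                      ≡⟨ cong (tot u +_) (sym (tot-concat-hword ds)) ⟩
    tot u + tot (concat (map hword ds))  ≡⟨ sym (sum-++ u (concat (map hword ds))) ⟩
    tot (u ++ concat (map hword ds))     ∎
    where
    open ≡-Reasoning
    I = sum (map D-index ds)
    T = sum (map (tot ∘ D-word) ds)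

  wpix-toW : ∀ d → length (proj₁ (proj₁ d)) ≡ wpix (proj₁ (toW d))
  wpix-toW ((u , ni , _) , ds , _) = cong (length ∘ proj₁) (sym (hfact-hwords ds ni))

theorem2p3 : (r n : ℕ) → Σ (Dstar n r ⤖ W n r) (λ φ → (d : Dstar n r) →
    sum (map D-index (proj₁ (proj₂ d))) ≡ wlec (proj₁ (Bijection.to φ d))
  × sum (map D-index (proj₁ (proj₂ d))) + tot (proj₁ (proj₁ d))
      + sum (map (λ e → tot (D-word e)) (proj₁ (proj₂ d)))
      ≡ tot (proj₁ (Bijection.to φ d))
  × length (proj₁ (proj₁ d)) ≡ wpix (proj₁ (Bijection.to φ d)))
theorem2p3 r n =
  ↔⇒⤖ (mk↔ₛ′ toW fromW toW-fromW fromW-toW) ,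
  λ d → wlec-toW d , tot-toW d , wpix-toW d
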